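{- Let $\mathcal{C}$ be a bicartesian closed category, fix an interpretation $[\![b]\!]_{\mathcal{C}}$ of each base type $b$ as an object of $\mathcal{C}$, and interpret the typed $\lambda$-calculus with products, unit, sums, empty type and function types both in $\mathcal{C}$ and in the bicartesian closed category $[\mathcal{C}^{\mathrm{op}},\mathbf{Set}]_\times$, the latter with base types interpreted by $[\![b]\!]=\mathbf{y}[\![b]\!]_{\mathcal{C}}$. Then: (i) for every type $A$ there is an isomorphism $\theta_A:[\![A]\!]_{[\mathcal{C}^{\mathrm{op}},\mathbf{Set}]_\times}\cong\mathbf{y}[\![A]\!]_{\mathcal{C}}$; (ii) for every well-typed term $\Gamma\vdash M:A$, the square $\theta_A\circ[\![M]\!]_{[\mathcal{C}^{\mathrm{op}},\mathbf{Set}]_\times}=\mathbf{y}([\![M]\!]_{\mathcal{C}})\circ i\circ\prod_{(x:B)\in\Gamma}\theta_B$ commutes, as maps $[\![\Gamma]\!]_{[\mathcal{C}^{\mathrm{op}},\mathbf{Set}]_\times}\to\mathbf{y}[\![A]\!]_{\mathcal{C}}$, where $[\![\Gamma]\!]=\prod_{(x:B)\in\Gamma}[\![B]\!]$ and $i:\prod_{(x:B)\in\Gamma}\mathbf{y}[\![B]\!]_{\mathcal{C}}\xrightarrow{\cong}\mathbf{y}\prod_{(x:B)\in\Gamma}[\![B]\!]_{\mathcal{C}}$ is the canonical isomorphism expressing that $\mathbf{y}$ preserves finite products.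
   Context: $[\mathcal{C}^{\mathrm{op}},\mathbf{Set}]_\times$ is the category of presheaves $\mathcal{C}^{\mathrm{op}}\to\mathbf{Set}$ that send finite coproducts of $\mathcal{C}$ to finite products of sets (product-preserving presheaves), with natural transformations. $\mathbf{y}:\mathcal{C}\to[\mathcal{C}^{\mathrm{op}},\mathbf{Set}]_\times$, $\mathbf{y}c=\mathcal{C}(-,c)$, is the Yoneda embedding (representables are product-preserving). When $\mathcal{C}$ is bicartesian closed (hence distributive), $[\mathcal{C}^{\mathrm{op}},\mathbf{Set}]_\times$ is bicartesian closed. Types of the typed $\lambda$-calculus: base types, $1$, $A\times B$, $0$, $A+B$, $A\to B$; in a bicartesian closed category these are interpreted by terminal object, product, initial object, coproduct and exponential, and a term $\Gamma\vdash M:A$ is interpreted as a morphism $[\![\Gamma]\!]\to[\![A]\!]$ in the standard way. -}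

module Defs where

open import Level using (Level; _⊔_; suc)
open import Relation.Binary using (Rel; IsEquivalence; Setoid)
open import Function.Bundles using (Func)
open import Data.Product using (Σ-syntax; _,_)
import Data.Product as Prod

record Category (o ℓ e : Level) : Set (suc (o ⊔ ℓ ⊔ e)) where
  infixr 9 _∘_
  infix  4 _≈_ _⇒_
  field
    Obj : Set o
    _⇒_ : Obj → Obj → Set ℓ
    _≈_ : ∀ {A B} → Rel (A ⇒ B) e
    id  : ∀ {A} → A ⇒ A
    _∘_ : ∀ {A B C} → B ⇒ C → A ⇒ B → A ⇒ C
    equiv     : ∀ {A B} → IsEquivalence (_≈_ {A} {B})
    ∘-resp-≈  : ∀ {A B C} {f h : B ⇒ C} {g i : A ⇒ B} → f ≈ h → g ≈ i → f ∘ g ≈ h ∘ i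
    assoc     : ∀ {A B C D} {f : A ⇒ B} {g : B ⇒ C} {h : C ⇒ D} → (h ∘ g) ∘ f ≈ h ∘ (g ∘ f)
    identityˡ : ∀ {A B} {f : A ⇒ B} → id ∘ f ≈ f
    identityʳ : ∀ {A B} {f : A ⇒ B} → f ∘ id ≈ f

  module Eq {A B : Obj} = IsEquivalence (equiv {A} {B})

  hom-setoid : Obj → Obj → Setoid ℓ e
  hom-setoid A B = record { Carrier = A ⇒ B ; _≈_ = _≈_ ; isEquivalence = equiv }

record Iso {o ℓ e} (C : Category o ℓ e) (A B : Category.Obj C) : Set (ℓ ⊔ e) where
  open Category C
  field
    to   : A ⇒ B
    from : B ⇒ A
    isoˡ : from ∘ to ≈ id
    isoʳ : to ∘ from ≈ id

record BCC {o ℓ e} (C : Category o ℓ e) : Set (o ⊔ ℓ ⊔ e) where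
  open Category C
  infixr 7 _⊗_
  infixr 6 _⊕_
  infixr 5 _⇨_
  field
    𝟙        : Obj
    !        : ∀ {A} → A ⇒ 𝟙
    !-unique : ∀ {A} (f : A ⇒ 𝟙) → ! ≈ f

    _⊗_      : Obj → Obj → Obj
    π₁       : ∀ {A B} → A ⊗ B ⇒ A
    π₂       : ∀ {A B} → A ⊗ B ⇒ B
    ⟨_,_⟩    : ∀ {A B X} → X ⇒ A → X ⇒ B → X ⇒ A ⊗ B
    project₁ : ∀ {A B X} {f : X ⇒ A} {g : X ⇒ B} → π₁ ∘ ⟨ f , g ⟩ ≈ f
    project₂ : ∀ {A B X} {f : X ⇒ A} {g : X ⇒ B} → π₂ ∘ ⟨ f , g ⟩ ≈ g
    ⊗-unique : ∀ {A B X} {h : X ⇒ A ⊗ B} {f : X ⇒ A} {g : X ⇒ B} →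
               π₁ ∘ h ≈ f → π₂ ∘ h ≈ g → ⟨ f , g ⟩ ≈ h

    𝟘        : Obj
    ¡        : ∀ {A} → 𝟘 ⇒ A
    ¡-unique : ∀ {A} (f : 𝟘 ⇒ A) → ¡ ≈ f

    _⊕_      : Obj → Obj → Obj
    i₁       : ∀ {A B} → A ⇒ A ⊕ B
    i₂       : ∀ {A B} → B ⇒ A ⊕ B
    [_,_]    : ∀ {A B X} → A ⇒ X → B ⇒ X → A ⊕ B ⇒ X
    inject₁  : ∀ {A B X} {f : A ⇒ X} {g : B ⇒ X} → [ f , g ] ∘ i₁ ≈ f
    inject₂  : ∀ {A B X} {f : A ⇒ X} {g : B ⇒ X} → [ f , g ] ∘ i₂ ≈ g
    ⊕-unique : ∀ {A B X} {h : A ⊕ B ⇒ X} {f : A ⇒ X} {g : B ⇒ X} →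
               h ∘ i₁ ≈ f → h ∘ i₂ ≈ g → [ f , g ] ≈ h

    _⇨_          : Obj → Obj → Obj
    eval         : ∀ {A B} → (A ⇨ B) ⊗ A ⇒ B
    curry        : ∀ {A B X} → X ⊗ A ⇒ B → X ⇒ A ⇨ B
    eval-curry   : ∀ {A B X} {f : X ⊗ A ⇒ B} → eval ∘ ⟨ curry f ∘ π₁ , π₂ ⟩ ≈ f
    curry-unique : ∀ {A B X} {f : X ⊗ A ⇒ B} {h : X ⇒ A ⇨ B} →
                   eval ∘ ⟨ h ∘ π₁ , π₂ ⟩ ≈ f → h ≈ curry f

  infixr 8 _⁂_
  _⁂_ : ∀ {A B X Y} → A ⇒ B → X ⇒ Y → A ⊗ X ⇒ B ⊗ Y
  f ⁂ g = ⟨ f ∘ π₁ , g ∘ π₂ ⟩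

  swap : ∀ {A B} → A ⊗ B ⇒ B ⊗ A
  swap = ⟨ π₂ , π₁ ⟩

  ⟨⟩-cong : ∀ {A B X} {f f′ : X ⇒ A} {g g′ : X ⇒ B} → f ≈ f′ → g ≈ g′ → ⟨ f , g ⟩ ≈ ⟨ f′ , g′ ⟩
  ⟨⟩-cong p q = Eq.sym (⊗-unique (Eq.trans project₁ p) (Eq.trans project₂ q))

  ⟨⟩∘ : ∀ {A B X Y} {f : X ⇒ A} {g : X ⇒ B} {k : Y ⇒ X} → ⟨ f ∘ k , g ∘ k ⟩ ≈ ⟨ f , g ⟩ ∘ k
  ⟨⟩∘ = ⊗-unique (Eq.trans (Eq.sym assoc) (∘-resp-≈ project₁ Eq.refl))
                 (Eq.trans (Eq.sym assoc) (∘-resp-≈ project₂ Eq.refl))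

module Syntax {b : Level} (Base : Set b) where

  infixr 7 _`×_
  infixr 6 _`+_
  infixr 5 _`→_
  data Ty : Set b where
    base  : Base → Ty
    `1    : Ty
    _`×_  : Ty → Ty → Ty
    `0    : Ty
    _`+_  : Ty → Ty → Ty
    _`→_  : Ty → Ty → Ty

  infixl 4 _,_
  data Ctx : Set b where
    ∅   : Ctx
    _,_ : Ctx → Ty → Ctx

  infix 3 _∋_ _⊢_
  data _∋_ : Ctx → Ty → Set b where
    here  : ∀ {Γ A} → Γ , A ∋ A
    there : ∀ {Γ A B} → Γ ∋ A → Γ , B ∋ A

  data _⊢_ : Ctx → Ty → Set b where
    var    : ∀ {Γ A} → Γ ∋ A → Γ ⊢ A
    unit   : ∀ {Γ} → Γ ⊢ `1
    pair   : ∀ {Γ A B} → Γ ⊢ A → Γ ⊢ B → Γ ⊢ A `× B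
    fst    : ∀ {Γ A B} → Γ ⊢ A `× B → Γ ⊢ A
    snd    : ∀ {Γ A B} → Γ ⊢ A `× B → Γ ⊢ B
    absurd : ∀ {Γ A} → Γ ⊢ `0 → Γ ⊢ A
    inl    : ∀ {Γ A B} → Γ ⊢ A → Γ ⊢ A `+ B
    inr    : ∀ {Γ A B} → Γ ⊢ B → Γ ⊢ A `+ B
    case   : ∀ {Γ A B C} → Γ ⊢ A `+ B → Γ , A ⊢ C → Γ , B ⊢ C → Γ ⊢ C
    lam    : ∀ {Γ A B} → Γ , A ⊢ B → Γ ⊢ A `→ B
    app    : ∀ {Γ A B} → Γ ⊢ A `→ B → Γ ⊢ A → Γ ⊢ B

module Interp {o ℓ e b : Level} (C : Category o ℓ e) (BC : BCC C)
              {Base : Set b} (⟦_⟧ᵇ : Base → Category.Obj C) where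
  open Category C
  open BCC BC
  open Syntax Base

  ⟦_⟧T : Ty → Obj
  ⟦ base β ⟧T = ⟦ β ⟧ᵇ
  ⟦ `1 ⟧T     = 𝟙
  ⟦ A `× B ⟧T = ⟦ A ⟧T ⊗ ⟦ B ⟧T
  ⟦ `0 ⟧T     = 𝟘
  ⟦ A `+ B ⟧T = ⟦ A ⟧T ⊕ ⟦ B ⟧T
  ⟦ A `→ B ⟧T = ⟦ A ⟧T ⇨ ⟦ B ⟧T

  ⟦_⟧C : Ctx → Obj
  ⟦ ∅ ⟧C     = 𝟙
  ⟦ Γ , A ⟧C = ⟦ Γ ⟧C ⊗ ⟦ A ⟧T

  ⟦_⟧v : ∀ {Γ A} → Γ ∋ A → ⟦ Γ ⟧C ⇒ ⟦ A ⟧T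
  ⟦ here ⟧v    = π₂
  ⟦ there x ⟧v = ⟦ x ⟧v ∘ π₁

  ⟦_⟧ : ∀ {Γ A} → Γ ⊢ A → ⟦ Γ ⟧C ⇒ ⟦ A ⟧T
  ⟦ var x ⟧      = ⟦ x ⟧v
  ⟦ unit ⟧       = !
  ⟦ pair M N ⟧   = ⟨ ⟦ M ⟧ , ⟦ N ⟧ ⟩
  ⟦ fst M ⟧      = π₁ ∘ ⟦ M ⟧
  ⟦ snd M ⟧      = π₂ ∘ ⟦ M ⟧
  ⟦ absurd M ⟧   = ¡ ∘ ⟦ M ⟧
  ⟦ inl M ⟧      = i₁ ∘ ⟦ M ⟧
  ⟦ inr M ⟧      = i₂ ∘ ⟦ M ⟧
  ⟦ case N M₁ M₂ ⟧ =
    eval ∘ ⟨ [ curry (⟦ M₁ ⟧ ∘ swap) , curry (⟦ M₂ ⟧ ∘ swap) ] ∘ ⟦ N ⟧ , id ⟩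
  ⟦ lam M ⟧      = curry ⟦ M ⟧
  ⟦ app M N ⟧    = eval ∘ ⟨ ⟦ M ⟧ , ⟦ N ⟧ ⟩

module Presheaves {o ℓ e : Level} (C : Category o ℓ e) (BC : BCC C) where
  open Category C
  open BCC BC
  open Setoid using (Carrier)

  record Presheaf : Set (o ⊔ suc (ℓ ⊔ e)) where
    field
      F₀ : Obj → Setoid ℓ e
      F₁ : ∀ {A B} → A ⇒ B → Func (F₀ B) (F₀ A)
    _∶_≈_ : ∀ A → Rel (Carrier (F₀ A)) e
    A ∶ x ≈ y = Setoid._≈_ (F₀ A) x y
    act : ∀ {A B} → A ⇒ B → Carrier (F₀ B) → Carrier (F₀ A)
    act f = Func.to (F₁ f)
    field
      F-resp-≈     : ∀ {A B} {f g : A ⇒ B} → f ≈ g → ∀ x → A ∶ act f x ≈ act g x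
      identity     : ∀ {A} x → A ∶ act id x ≈ x
      homomorphism : ∀ {A B X} {f : A ⇒ B} {g : B ⇒ X} x →
                     A ∶ act (g ∘ f) x ≈ act f (act g x)

  -- F sends the initial object to a one-element set and binary coproducts
  -- to binary products: the canonical map F(A+B) → F A × F B,
  -- x ↦ (F i₁ x , F i₂ x), is a bijection (of setoids).
  record IsProductPreserving (F : Presheaf) : Set (o ⊔ ℓ ⊔ e) where
    open Presheaf F
    field
      pres-𝟘       : Σ[ x ∈ Carrier (F₀ 𝟘) ] (∀ y → 𝟘 ∶ y ≈ x)
      pres-⊕-inj   : ∀ {A B} (x y : Carrier (F₀ (A ⊕ B))) →
                     A ∶ act i₁ x ≈ act i₁ y → B ∶ act i₂ x ≈ act i₂ y → (A ⊕ B) ∶ x ≈ y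
      pres-⊕-surj  : ∀ {A B} (a : Carrier (F₀ A)) (c : Carrier (F₀ B)) →
                     Σ[ x ∈ Carrier (F₀ (A ⊕ B)) ] (A ∶ act i₁ x ≈ a Prod.× B ∶ act i₂ x ≈ c)

  record PPresheaf : Set (o ⊔ suc (ℓ ⊔ e)) where
    field
      presheaf  : Presheaf
      preserves : IsProductPreserving presheaf
    open Presheaf presheaf public

  record NatTrans (F G : PPresheaf) : Set (o ⊔ ℓ ⊔ e) where
    private
      module F = PPresheaf F
      module G = PPresheaf G
    field
      η       : ∀ A → Func (F.F₀ A) (G.F₀ A)
      natural : ∀ {A B} (f : A ⇒ B) x →
                A G.∶ Func.to (η A) (F.act f x) ≈ G.act f (Func.to (η B) x)
    app : ∀ A → Carrier (F.F₀ A) → Carrier (G.F₀ A)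
    app A = Func.to (η A)

  _≈ⁿ_ : ∀ {F G} → Rel (NatTrans F G) (o ⊔ ℓ ⊔ e)
  _≈ⁿ_ {F} {G} α β = ∀ A x → A G.∶ NatTrans.app α A x ≈ NatTrans.app β A x
    where module G = PPresheaf G

  idⁿ : ∀ {F} → NatTrans F F
  idⁿ {F} = record
    { η = λ A → record { to = λ x → x ; cong = λ p → p }
    ; natural = λ f x → Setoid.refl (F.F₀ _) }
    where module F = PPresheaf F

  _∘ⁿ_ : ∀ {F G H} → NatTrans G H → NatTrans F G → NatTrans F H
  _∘ⁿ_ {F} {G} {H} α β = record
    { η = λ A → record { to = λ x → α.app A (β.app A x)
                       ; cong = λ p → Func.cong (α.η A) (Func.cong (β.η A) p) }
    ; natural = λ f x → Setoid.trans (H.F₀ _)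
        (Func.cong (α.η _) (β.natural f x)) (α.natural f (β.app _ x)) }
    where
      module α = NatTrans α
      module β = NatTrans β
      module H = PPresheaf H

  PSh× : Category (o ⊔ suc (ℓ ⊔ e)) (o ⊔ ℓ ⊔ e) (o ⊔ ℓ ⊔ e)
  PSh× = record
    { Obj = PPresheaf
    ; _⇒_ = NatTrans
    ; _≈_ = _≈ⁿ_
    ; id = idⁿ
    ; _∘_ = _∘ⁿ_
    ; equiv = λ {F} {G} → record
        { refl  = λ A x → Setoid.refl (PPresheaf.F₀ G A)
        ; sym   = λ p A x → Setoid.sym (PPresheaf.F₀ G A) (p A x)
        ; trans = λ p q A x → Setoid.trans (PPresheaf.F₀ G A) (p A x) (q A x) }
    ; ∘-resp-≈ = λ {_} {_} {H} {f} {h} {g} {i} p q A x →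
        Setoid.trans (PPresheaf.F₀ H A) (Func.cong (NatTrans.η f A) (q A x)) (p A (NatTrans.app i A x))
    ; assoc = λ {_} {_} {_} {D} A x → Setoid.refl (PPresheaf.F₀ D A)
    ; identityˡ = λ {_} {B} A x → Setoid.refl (PPresheaf.F₀ B A)
    ; identityʳ = λ {_} {B} A x → Setoid.refl (PPresheaf.F₀ B A)
    }

  yPsh : Obj → Presheaf
  yPsh c = record
    { F₀ = λ A → hom-setoid A c
    ; F₁ = λ f → record { to = λ g → g ∘ f ; cong = λ p → ∘-resp-≈ p Eq.refl }
    ; F-resp-≈ = λ p g → ∘-resp-≈ Eq.refl p
    ; identity = λ g → identityʳ
    ; homomorphism = λ g → Eq.sym assoc
    }

  y-preserves : ∀ c → IsProductPreserving (yPsh c)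
  y-preserves c = record
    { pres-𝟘 = ¡ , λ g → Eq.sym (¡-unique g)
    ; pres-⊕-inj = λ g h p q →
        Eq.trans (Eq.sym (⊕-unique p q)) (⊕-unique Eq.refl Eq.refl)
    ; pres-⊕-surj = λ a d → [ a , d ] , (inject₁ , inject₂)
    }

  y : Obj → PPresheaf
  y c = record { presheaf = yPsh c ; preserves = y-preserves c }

  y₁ : ∀ {c d} → c ⇒ d → NatTrans (y c) (y d)
  y₁ f = record
    { η = λ A → record { to = λ g → f ∘ g ; cong = λ p → ∘-resp-≈ Eq.refl p }
    ; natural = λ k g → Eq.sym assoc }

module Comparison {o ℓ e b : Level} (C : Category o ℓ e) (BC : BCC C)
                  {Base : Set b} (⟦_⟧ᵇ : Base → Category.Obj C)
                  (BP : BCC (Presheaves.PSh× C BC)) where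
  open Presheaves C BC
  open Syntax Base
  module C = Category C
  module BC = BCC BC
  module P = Category PSh×
  module BP = BCC BP
  module Iᶜ = Interp C BC ⟦_⟧ᵇ
  module Iᴾ = Interp PSh× BP (λ β → y ⟦ β ⟧ᵇ)

  y∏ : Ctx → P.Obj
  y∏ ∅       = BP.𝟙
  y∏ (Γ , A) = y∏ Γ BP.⊗ y (Iᶜ.⟦ A ⟧T)

  ε : BP.𝟙 P.⇒ y BC.𝟙
  ε = record
    { η = λ A → record { to = λ _ → BC.! ; cong = λ _ → C.Eq.refl }
    ; natural = λ k _ → BC.!-unique _ }

  φ : ∀ X Y → y X BP.⊗ y Y P.⇒ y (X BC.⊗ Y)
  φ X Y = record
    { η = λ A → record
        { to = λ z → BC.⟨ NatTrans.app BP.π₁ A z , NatTrans.app BP.π₂ A z ⟩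
        ; cong = λ p → BC.⟨⟩-cong (Func.cong (NatTrans.η BP.π₁ A) p)
                                   (Func.cong (NatTrans.η BP.π₂ A) p) }
    ; natural = λ k z → C.Eq.trans
        (BC.⟨⟩-cong (NatTrans.natural BP.π₁ k z) (NatTrans.natural BP.π₂ k z))
        BC.⟨⟩∘ }

  i : ∀ Γ → y∏ Γ P.⇒ y (Iᶜ.⟦ Γ ⟧C)
  i ∅       = ε
  i (Γ , A) = φ (Iᶜ.⟦ Γ ⟧C) (Iᶜ.⟦ A ⟧T) P.∘ (i Γ BP.⁂ P.id)

  ∏θ : (θ : ∀ A → Iso PSh× (Iᴾ.⟦ A ⟧T) (y (Iᶜ.⟦ A ⟧T))) → ∀ Γ → Iᴾ.⟦ Γ ⟧C P.⇒ y∏ Γ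
  ∏θ θ ∅       = P.id
  ∏θ θ (Γ , A) = ∏θ θ Γ BP.⁂ Iso.to (θ A)

-- The Yoneda embedding y : C → [Cᵒᵖ, Set]× preserves the bicartesian closed structure up to the
-- canonical comparison maps: finite products and exponentials by the Yoneda lemma, 𝟘 and + because
-- the presheaves involved are product preserving. For any functor F : D → E preserving the structure
-- in this sense, induction on types gives isomorphisms θ_A : ⟦A⟧_E ≅ F ⟦A⟧_D, and induction on terms
-- shows that every structural morphism of E corresponds under θ to F of the matching morphism of D,
-- whence θ_A ∘ ⟦M⟧_E = F ⟦M⟧_D ∘ θ_Γ. For F = y the context isomorphism θ_Γ factors as i ∘ ∏ θ_B.
module Submission where

open import Level using (Level; _⊔_)
open import Data.Product using (Σ-syntax; _,_; proj₁; proj₂)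
open import Relation.Binary using (Setoid)
import Relation.Binary.Reasoning.Setoid as SetoidReasoning
open import Function.Bundles using (Func)
open import Defs

module CategoryProperties {o ℓ e} (D : Category o ℓ e) where
  open Category D

  module HomReasoning {A B : Obj} where
    open SetoidReasoning (hom-setoid A B) public

  open HomReasoning

  private variable
    A B X Y Z : Obj
    f g h k : A ⇒ B

  ∘-resp-≈ˡ : f ≈ h → f ∘ g ≈ h ∘ g
  ∘-resp-≈ˡ p = ∘-resp-≈ p Eq.refl

  ∘-resp-≈ʳ : g ≈ h → f ∘ g ≈ f ∘ h
  ∘-resp-≈ʳ p = ∘-resp-≈ Eq.refl p

  pullʳ : g ∘ h ≈ k → (f ∘ g) ∘ h ≈ f ∘ k
  pullʳ p = Eq.trans assoc (∘-resp-≈ʳ p)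

  pullˡ : f ∘ g ≈ k → f ∘ (g ∘ h) ≈ k ∘ h
  pullˡ p = Eq.trans (Eq.sym assoc) (∘-resp-≈ˡ p)

  elimʳ : g ≈ id → f ∘ g ≈ f
  elimʳ p = Eq.trans (∘-resp-≈ʳ p) identityʳ

  elimˡ : f ≈ id → f ∘ g ≈ g
  elimˡ p = Eq.trans (∘-resp-≈ˡ p) identityˡ

  cancelˡ : f ∘ g ≈ id → f ∘ (g ∘ h) ≈ h
  cancelˡ p = Eq.trans (pullˡ p) identityˡ

  idᵢ : Iso D A A
  idᵢ = record { to = id ; from = id ; isoˡ = identityˡ ; isoʳ = identityˡ }

  infixr 9 _∘ᵢ_
  _∘ᵢ_ : Iso D Y Z → Iso D X Y → Iso D X Z
  S ∘ᵢ R = record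
    { to   = S.to ∘ R.to
    ; from = R.from ∘ S.from
    ; isoˡ = Eq.trans (pullʳ (cancelˡ S.isoˡ)) R.isoˡ
    ; isoʳ = Eq.trans (pullʳ (cancelˡ R.isoʳ)) S.isoʳ
    }
    where
      module R = Iso R
      module S = Iso S

module BCCProperties {o ℓ e} {D : Category o ℓ e} (BD : BCC D) where
  open Category D
  open BCC BD
  open CategoryProperties D
  open HomReasoning

  private variable
    A B X Y Z : Obj
    f g h k f′ g′ : A ⇒ B

  !-unique₂ : {f g : A ⇒ 𝟙} → f ≈ g
  !-unique₂ = Eq.trans (Eq.sym (!-unique _)) (!-unique _)

  ¡-unique₂ : {f g : 𝟘 ⇒ A} → f ≈ g
  ¡-unique₂ = Eq.trans (Eq.sym (¡-unique _)) (¡-unique _)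

  ⊗-ext : π₁ ∘ h ≈ π₁ ∘ k → π₂ ∘ h ≈ π₂ ∘ k → h ≈ k
  ⊗-ext p q = Eq.trans (Eq.sym (⊗-unique Eq.refl Eq.refl)) (⊗-unique (Eq.sym p) (Eq.sym q))

  ⁂-cong : f ≈ h → g ≈ k → f ⁂ g ≈ h ⁂ k
  ⁂-cong p q = ⟨⟩-cong (∘-resp-≈ˡ p) (∘-resp-≈ˡ q)

  ⁂-identity : id ⁂ id ≈ id {A ⊗ B}
  ⁂-identity = ⊗-unique (Eq.trans identityʳ (Eq.sym identityˡ)) (Eq.trans identityʳ (Eq.sym identityˡ))

  ⁂∘⟨⟩ : (f ⁂ g) ∘ ⟨ h , k ⟩ ≈ ⟨ f ∘ h , g ∘ k ⟩
  ⁂∘⟨⟩ = Eq.sym (⊗-unique (Eq.trans (pullˡ project₁) (pullʳ project₁))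
                          (Eq.trans (pullˡ project₂) (pullʳ project₂)))

  ⁂∘⁂ : (f ⁂ g) ∘ (h ⁂ k) ≈ (f ∘ h) ⁂ (g ∘ k)
  ⁂∘⁂ = Eq.trans ⁂∘⟨⟩ (⟨⟩-cong (Eq.sym assoc) (Eq.sym assoc))

  first∘first : (f ⁂ id) ∘ (g ⁂ id) ≈ (f ∘ g) ⁂ id {A}
  first∘first = Eq.trans ⁂∘⁂ (⁂-cong Eq.refl identityˡ)

  second∘second : (id ⁂ f) ∘ (id ⁂ g) ≈ id {A} ⁂ (f ∘ g)
  second∘second = Eq.trans ⁂∘⁂ (⁂-cong identityˡ Eq.refl)

  first∘second : (f ⁂ id) ∘ (id ⁂ g) ≈ f ⁂ g
  first∘second = Eq.trans ⁂∘⁂ (⁂-cong identityʳ identityˡ)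

  first↔second : (id ⁂ g) ∘ (f ⁂ id) ≈ (f ⁂ id) ∘ (id ⁂ g)
  first↔second = Eq.trans ⁂∘⁂ (Eq.trans (⁂-cong identityˡ identityʳ) (Eq.sym first∘second))

  ⊕-ext : h ∘ i₁ ≈ k ∘ i₁ → h ∘ i₂ ≈ k ∘ i₂ → h ≈ k
  ⊕-ext p q = Eq.trans (Eq.sym (⊕-unique Eq.refl Eq.refl)) (⊕-unique (Eq.sym p) (Eq.sym q))

  []-cong : f ≈ h → g ≈ k → [ f , g ] ≈ [ h , k ]
  []-cong p q = Eq.sym (⊕-unique (Eq.trans inject₁ p) (Eq.trans inject₂ q))

  ∘[] : h ∘ [ f , g ] ≈ [ h ∘ f , h ∘ g ]
  ∘[] = Eq.sym (⊕-unique (pullʳ inject₁) (pullʳ inject₂))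

  infixr 6 _⊕₁_
  _⊕₁_ : A ⇒ B → X ⇒ Y → A ⊕ X ⇒ B ⊕ Y
  f ⊕₁ g = [ i₁ ∘ f , i₂ ∘ g ]

  []∘⊕₁ : [ f , g ] ∘ (h ⊕₁ k) ≈ [ f ∘ h , g ∘ k ]
  []∘⊕₁ = Eq.trans ∘[] ([]-cong (pullˡ inject₁) (pullˡ inject₂))

  ⊕₁∘⊕₁ : (f ⊕₁ g) ∘ (h ⊕₁ k) ≈ (f ∘ h) ⊕₁ (g ∘ k)
  ⊕₁∘⊕₁ = Eq.trans []∘⊕₁ ([]-cong assoc assoc)

  ⊕₁-cong : f ≈ h → g ≈ k → f ⊕₁ g ≈ h ⊕₁ k
  ⊕₁-cong p q = []-cong (∘-resp-≈ʳ p) (∘-resp-≈ʳ q)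

  ⊕₁-identity : id ⊕₁ id ≈ id {A ⊕ B}
  ⊕₁-identity = ⊕-unique (Eq.trans identityˡ (Eq.sym identityʳ)) (Eq.trans identityˡ (Eq.sym identityʳ))

  β : eval ∘ (curry f ⁂ id) ≈ f
  β = Eq.trans (∘-resp-≈ʳ (⟨⟩-cong Eq.refl identityˡ)) eval-curry

  eval∘⟨curry⟩ : eval ∘ ⟨ curry f ∘ k , g ⟩ ≈ f ∘ ⟨ k , g ⟩
  eval∘⟨curry⟩ {f = f} {k = k} {g = g} = begin
    eval ∘ ⟨ curry f ∘ k , g ⟩         ≈⟨ ∘-resp-≈ʳ (⟨⟩-cong Eq.refl identityˡ) ⟨
    eval ∘ ⟨ curry f ∘ k , id ∘ g ⟩    ≈⟨ ∘-resp-≈ʳ ⁂∘⟨⟩ ⟨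
    eval ∘ (curry f ⁂ id) ∘ ⟨ k , g ⟩  ≈⟨ pullˡ β ⟩
    f ∘ ⟨ k , g ⟩                      ∎

  curry-unique′ : eval ∘ (h ⁂ id) ≈ f → h ≈ curry f
  curry-unique′ p = curry-unique (Eq.trans (∘-resp-≈ʳ (⟨⟩-cong Eq.refl (Eq.sym identityˡ))) p)

  curry-cong : f ≈ g → curry f ≈ curry g
  curry-cong p = curry-unique′ (Eq.trans β p)

  curry-eval : curry eval ≈ id {A ⇨ B}
  curry-eval = Eq.sym (curry-unique′ (elimʳ ⁂-identity))

  curry-∘ : curry f ∘ k ≈ curry (f ∘ (k ⁂ id))
  curry-∘ {f = f} {k = k} = curry-unique′ (begin
    eval ∘ ((curry f ∘ k) ⁂ id)          ≈⟨ ∘-resp-≈ʳ first∘first ⟨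
    eval ∘ (curry f ⁂ id) ∘ (k ⁂ id)     ≈⟨ pullˡ β ⟩
    f ∘ (k ⁂ id)                         ∎)

  curry∘≈id : f ∘ (h ⁂ id) ≈ eval → curry f ∘ h ≈ id
  curry∘≈id p = Eq.trans curry-∘ (Eq.trans (curry-cong p) curry-eval)

  infixr 5 _⇨₁_
  _⇨₁_ : B ⇒ A → X ⇒ Y → A ⇨ X ⇒ B ⇨ Y
  g ⇨₁ h = curry (h ∘ eval ∘ (id ⁂ g))

  ⇨₁-cong : f ≈ g → h ≈ k → f ⇨₁ h ≈ g ⇨₁ k
  ⇨₁-cong p q = curry-cong (∘-resp-≈ q (∘-resp-≈ʳ (⁂-cong Eq.refl p)))

  ⇨₁∘⇨₁ : (g ⇨₁ h) ∘ (g′ ⇨₁ f′) ≈ (g′ ∘ g) ⇨₁ (h ∘ f′)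
  ⇨₁∘⇨₁ {g = g} {h = h} {g′ = g′} {f′ = f′} = curry-unique′ (begin
    eval ∘ (((g ⇨₁ h) ∘ (g′ ⇨₁ f′)) ⁂ id)            ≈⟨ ∘-resp-≈ʳ first∘first ⟨
    eval ∘ ((g ⇨₁ h) ⁂ id) ∘ ((g′ ⇨₁ f′) ⁂ id)       ≈⟨ pullˡ β ⟩
    (h ∘ eval ∘ (id ⁂ g)) ∘ ((g′ ⇨₁ f′) ⁂ id)        ≈⟨ pullʳ (pullʳ first↔second) ⟩
    h ∘ eval ∘ ((g′ ⇨₁ f′) ⁂ id) ∘ (id ⁂ g)          ≈⟨ ∘-resp-≈ʳ (pullˡ β) ⟩
    h ∘ (f′ ∘ eval ∘ (id ⁂ g′)) ∘ (id ⁂ g)           ≈⟨ ∘-resp-≈ʳ (pullʳ (pullʳ second∘second)) ⟩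
    h ∘ f′ ∘ eval ∘ (id ⁂ (g′ ∘ g))                  ≈⟨ assoc ⟨
    (h ∘ f′) ∘ eval ∘ (id ⁂ (g′ ∘ g))                ∎)

  ⇨₁∘curry : (g ⇨₁ h) ∘ curry f ≈ curry (h ∘ f ∘ (id ⁂ g))
  ⇨₁∘curry {g = g} {h = h} {f = f} = Eq.trans curry-∘ (curry-cong (begin
    (h ∘ eval ∘ (id ⁂ g)) ∘ (curry f ⁂ id)    ≈⟨ pullʳ (pullʳ first↔second) ⟩
    h ∘ eval ∘ (curry f ⁂ id) ∘ (id ⁂ g)      ≈⟨ ∘-resp-≈ʳ (pullˡ β) ⟩
    h ∘ f ∘ (id ⁂ g)                          ∎))

  ⇨₁-identity : id ⇨₁ id ≈ id {A ⇨ B}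
  ⇨₁-identity = Eq.trans (curry-cong (Eq.trans identityˡ (elimʳ ⁂-identity))) curry-eval

  infixr 7 _⊗ᵢ_
  _⊗ᵢ_ : Iso D A B → Iso D X Y → Iso D (A ⊗ X) (B ⊗ Y)
  R ⊗ᵢ S = record
    { to   = R.to ⁂ S.to
    ; from = R.from ⁂ S.from
    ; isoˡ = Eq.trans ⁂∘⁂ (Eq.trans (⁂-cong R.isoˡ S.isoˡ) ⁂-identity)
    ; isoʳ = Eq.trans ⁂∘⁂ (Eq.trans (⁂-cong R.isoʳ S.isoʳ) ⁂-identity)
    }
    where
      module R = Iso R
      module S = Iso S

  infixr 6 _⊕ᵢ_
  _⊕ᵢ_ : Iso D A B → Iso D X Y → Iso D (A ⊕ X) (B ⊕ Y)
  R ⊕ᵢ S = record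
    { to   = R.to ⊕₁ S.to
    ; from = R.from ⊕₁ S.from
    ; isoˡ = Eq.trans ⊕₁∘⊕₁ (Eq.trans (⊕₁-cong R.isoˡ S.isoˡ) ⊕₁-identity)
    ; isoʳ = Eq.trans ⊕₁∘⊕₁ (Eq.trans (⊕₁-cong R.isoʳ S.isoʳ) ⊕₁-identity)
    }
    where
      module R = Iso R
      module S = Iso S

  infixr 5 _⇨ᵢ_
  _⇨ᵢ_ : Iso D A B → Iso D X Y → Iso D (A ⇨ X) (B ⇨ Y)
  R ⇨ᵢ S = record
    { to   = R.from ⇨₁ S.to
    ; from = R.to ⇨₁ S.from
    ; isoˡ = Eq.trans ⇨₁∘⇨₁ (Eq.trans (⇨₁-cong R.isoˡ S.isoˡ) ⇨₁-identity)
    ; isoʳ = Eq.trans ⇨₁∘⇨₁ (Eq.trans (⇨₁-cong R.isoʳ S.isoʳ) ⇨₁-identity)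
    }
    where
      module R = Iso R
      module S = Iso S

  morphisms-into-terminal-equal : Iso D 𝟙 Z → (f g : X ⇒ Z) → f ≈ g
  morphisms-into-terminal-equal I f g = begin
    f                    ≈⟨ cancelˡ I.isoʳ ⟨
    I.to ∘ I.from ∘ f    ≈⟨ ∘-resp-≈ʳ !-unique₂ ⟩
    I.to ∘ I.from ∘ g    ≈⟨ cancelˡ I.isoʳ ⟩
    g                    ∎
    where module I = Iso I

record Functor {o ℓ e o′ ℓ′ e′} (D : Category o ℓ e) (E : Category o′ ℓ′ e′)
               : Set (o ⊔ ℓ ⊔ e ⊔ o′ ⊔ ℓ′ ⊔ e′) where
  private
    module D = Category D
    module E = Category E
  field
    F₀           : D.Obj → E.Obj
    F₁           : ∀ {A B} → A D.⇒ B → F₀ A E.⇒ F₀ B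
    F-resp-≈     : ∀ {A B} {f g : A D.⇒ B} → f D.≈ g → F₁ f E.≈ F₁ g
    identity     : ∀ {A} → F₁ (D.id {A}) E.≈ E.id
    homomorphism : ∀ {A B X} {f : A D.⇒ B} {g : B D.⇒ X} → F₁ (g D.∘ f) E.≈ F₁ g E.∘ F₁ f

-- The laws make the comparison isomorphisms the canonical maps; for 𝟙 and 𝟘 this is automatic.
record StrongBCCFunctor {o ℓ e o′ ℓ′ e′} {D : Category o ℓ e} {E : Category o′ ℓ′ e′}
                        (BD : BCC D) (BE : BCC E) : Set (o ⊔ ℓ ⊔ e ⊔ o′ ⊔ ℓ′ ⊔ e′) where
  private
    module D = Category D
    module BD = BCC BD
  open Category E
  open BCC BE
  field
    functor : Functor D E
  open Functor functor public
  field
    𝟙-iso  : Iso E 𝟙 (F₀ BD.𝟙)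
    ⊗-iso  : ∀ c d → Iso E (F₀ c ⊗ F₀ d) (F₀ (c BD.⊗ d))
    F-π₁   : ∀ {c d} → F₁ BD.π₁ ∘ Iso.to (⊗-iso c d) ≈ π₁
    F-π₂   : ∀ {c d} → F₁ BD.π₂ ∘ Iso.to (⊗-iso c d) ≈ π₂
    𝟘-iso  : Iso E 𝟘 (F₀ BD.𝟘)
    ⊕-iso  : ∀ c d → Iso E (F₀ c ⊕ F₀ d) (F₀ (c BD.⊕ d))
    F-i₁   : ∀ {c d} → Iso.to (⊕-iso c d) ∘ i₁ ≈ F₁ BD.i₁
    F-i₂   : ∀ {c d} → Iso.to (⊕-iso c d) ∘ i₂ ≈ F₁ BD.i₂
    ⇨-iso  : ∀ c d → Iso E (F₀ c ⇨ F₀ d) (F₀ (c BD.⇨ d))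
    F-eval : ∀ {c d} → F₁ BD.eval ∘ Iso.to (⊗-iso (c BD.⇨ d) c) ∘ (Iso.to (⇨-iso c d) ⁂ id) ≈ eval

module StrongBCCFunctorProperties {o ℓ e o′ ℓ′ e′} {D : Category o ℓ e} {E : Category o′ ℓ′ e′}
                                  {BD : BCC D} {BE : BCC E} (F : StrongBCCFunctor BD BE) where
  open StrongBCCFunctor F
  private
    module D = Category D
    module BD = BCC BD
  open Category E
  open BCC BE
  open CategoryProperties E
  open HomReasoning
  open BCCProperties BE
  private
    module DP = BCCProperties BD
    module ⊗F {c d} = Iso (⊗-iso c d)
    module ⊕F {c d} = Iso (⊕-iso c d)
    module ⇨F {c d} = Iso (⇨-iso c d)
    variable
      c d : D.Obj
      f g : c D.⇒ d

  π₁∘⊗-iso⁻¹ : π₁ ∘ ⊗F.from ≈ F₁ (BD.π₁ {c} {d})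
  π₁∘⊗-iso⁻¹ = Eq.trans (∘-resp-≈ˡ (Eq.sym F-π₁)) (Eq.trans (pullʳ ⊗F.isoʳ) identityʳ)

  π₂∘⊗-iso⁻¹ : π₂ ∘ ⊗F.from ≈ F₁ (BD.π₂ {c} {d})
  π₂∘⊗-iso⁻¹ = Eq.trans (∘-resp-≈ˡ (Eq.sym F-π₂)) (Eq.trans (pullʳ ⊗F.isoʳ) identityʳ)

  F-⟨⟩ : ∀ {b c d} {f : b D.⇒ c} {g : b D.⇒ d} → F₁ BD.⟨ f , g ⟩ ≈ ⊗F.to ∘ ⟨ F₁ f , F₁ g ⟩
  F-⟨⟩ {b} {c} {d} {f} {g} = begin
    F₁ BD.⟨ f , g ⟩                    ≈⟨ cancelˡ ⊗F.isoʳ ⟨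
    ⊗F.to ∘ ⊗F.from ∘ F₁ BD.⟨ f , g ⟩  ≈⟨ ∘-resp-≈ʳ (Eq.sym (⊗-unique (component π₁∘⊗-iso⁻¹ BD.project₁)
                                                                       (component π₂∘⊗-iso⁻¹ BD.project₂))) ⟩
    ⊗F.to ∘ ⟨ F₁ f , F₁ g ⟩            ∎
    where
      component : ∀ {c′} {p : F₀ c ⊗ F₀ d ⇒ F₀ c′} {q : c BD.⊗ d D.⇒ c′} {h : b D.⇒ c′} →
                  p ∘ ⊗F.from ≈ F₁ q → q D.∘ BD.⟨ f , g ⟩ D.≈ h → p ∘ ⊗F.from ∘ F₁ BD.⟨ f , g ⟩ ≈ F₁ h
      component p q = Eq.trans (pullˡ p) (Eq.trans (Eq.sym homomorphism) (F-resp-≈ q))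

  F-⁂ : ∀ {a b c d} {f : a D.⇒ c} {g : b D.⇒ d} → F₁ (f BD.⁂ g) ∘ ⊗F.to ≈ ⊗F.to ∘ (F₁ f ⁂ F₁ g)
  F-⁂ {a} {b} {f = f} {g = g} = begin
    F₁ (f BD.⁂ g) ∘ ⊗F.to
      ≈⟨ ∘-resp-≈ˡ F-⟨⟩ ⟩
    (⊗F.to ∘ ⟨ F₁ (f D.∘ BD.π₁) , F₁ (g D.∘ BD.π₂) ⟩) ∘ ⊗F.to
      ≈⟨ pullʳ (Eq.sym ⟨⟩∘) ⟩
    ⊗F.to ∘ ⟨ F₁ (f D.∘ BD.π₁) ∘ ⊗F.to , F₁ (g D.∘ BD.π₂) ∘ ⊗F.to ⟩
      ≈⟨ ∘-resp-≈ʳ (⟨⟩-cong (through F-π₁) (through F-π₂)) ⟩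
    ⊗F.to ∘ (F₁ f ⁂ F₁ g)
      ∎
    where
      through : ∀ {a′ b′} {h : a′ D.⇒ b′} {p : a BD.⊗ b D.⇒ a′} {q : F₀ a ⊗ F₀ b ⇒ F₀ a′} →
                F₁ p ∘ ⊗F.to ≈ q → F₁ (h D.∘ p) ∘ ⊗F.to ≈ F₁ h ∘ q
      through r = Eq.trans (∘-resp-≈ˡ homomorphism) (pullʳ r)

  F-[] : F₁ BD.[ f , g ] ∘ ⊕F.to ≈ [ F₁ f , F₁ g ]
  F-[] = Eq.sym (⊕-unique (Eq.trans (pullʳ F-i₁) (Eq.trans (Eq.sym homomorphism) (F-resp-≈ BD.inject₁)))
                          (Eq.trans (pullʳ F-i₂) (Eq.trans (Eq.sym homomorphism) (F-resp-≈ BD.inject₂))))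

  F-curry : F₁ (BD.curry f) ≈ ⇨F.to ∘ curry (F₁ f ∘ ⊗F.to)
  F-curry {f = f} = begin
    F₁ (BD.curry f)                      ≈⟨ cancelˡ ⇨F.isoʳ ⟨
    ⇨F.to ∘ ⇨F.from ∘ F₁ (BD.curry f)    ≈⟨ ∘-resp-≈ʳ (curry-unique′ transposed) ⟩
    ⇨F.to ∘ curry (F₁ f ∘ ⊗F.to)         ∎
    where
      transposed : eval ∘ ((⇨F.from ∘ F₁ (BD.curry f)) ⁂ id) ≈ F₁ f ∘ ⊗F.to
      transposed = begin
        eval ∘ ((⇨F.from ∘ F₁ (BD.curry f)) ⁂ id)
          ≈⟨ ∘-resp-≈ˡ F-eval ⟨
        (F₁ BD.eval ∘ ⊗F.to ∘ (⇨F.to ⁂ id)) ∘ ((⇨F.from ∘ F₁ (BD.curry f)) ⁂ id)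
          ≈⟨ pullʳ (pullʳ (Eq.trans ⁂∘⁂ (⁂-cong (cancelˡ ⇨F.isoʳ) (Eq.trans identityˡ (Eq.sym identity))))) ⟩
        F₁ BD.eval ∘ ⊗F.to ∘ (F₁ (BD.curry f) ⁂ F₁ D.id)
          ≈⟨ ∘-resp-≈ʳ F-⁂ ⟨
        F₁ BD.eval ∘ F₁ (BD.curry f BD.⁂ D.id) ∘ ⊗F.to
          ≈⟨ pullˡ (Eq.sym homomorphism) ⟩
        F₁ (BD.eval D.∘ (BD.curry f BD.⁂ D.id)) ∘ ⊗F.to
          ≈⟨ ∘-resp-≈ˡ (F-resp-≈ DP.β) ⟩
        F₁ f ∘ ⊗F.to
          ∎

  Rep : Obj → D.Obj → Set (ℓ′ ⊔ e′)
  Rep P c = Iso E P (F₀ c)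

  infixr 7 _⊗ᵣ_
  _⊗ᵣ_ : ∀ {P Q c d} → Rep P c → Rep Q d → Rep (P ⊗ Q) (c BD.⊗ d)
  R ⊗ᵣ S = ⊗-iso _ _ ∘ᵢ (R ⊗ᵢ S)

  infixr 6 _⊕ᵣ_
  _⊕ᵣ_ : ∀ {P Q c d} → Rep P c → Rep Q d → Rep (P ⊕ Q) (c BD.⊕ d)
  R ⊕ᵣ S = ⊕-iso _ _ ∘ᵢ (R ⊕ᵢ S)

  infixr 5 _⇨ᵣ_
  _⇨ᵣ_ : ∀ {P Q c d} → Rep P c → Rep Q d → Rep (P ⇨ Q) (c BD.⇨ d)
  R ⇨ᵣ S = ⇨-iso _ _ ∘ᵢ (R ⇨ᵢ S)

  to-⊗ᵣ-factors : ∀ {P Q X c d} (R : Rep P c) (S : Rep Q d) {f : X ⇒ F₀ c} {g : P ⇒ X} →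
                  Iso.to R ≈ f ∘ g → Iso.to (R ⊗ᵣ S) ≈ (⊗F.to ∘ (f ⁂ id)) ∘ (g ⁂ Iso.to S)
  to-⊗ᵣ-factors R S {f} {g} p = begin
    ⊗F.to ∘ (Iso.to R ⁂ Iso.to S)           ≈⟨ ∘-resp-≈ʳ (⁂-cong p (Eq.sym identityˡ)) ⟩
    ⊗F.to ∘ ((f ∘ g) ⁂ (id ∘ Iso.to S))     ≈⟨ pullʳ ⁂∘⁂ ⟨
    (⊗F.to ∘ (f ⁂ id)) ∘ (g ⁂ Iso.to S)     ∎

  record Tracks {P Q c d} (R : Rep P c) (S : Rep Q d) (f : P ⇒ Q) (g : c D.⇒ d) : Set e′ where
    constructor tracks
    field square : Iso.to S ∘ f ≈ F₁ g ∘ Iso.to R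

  tracks-id : ∀ {P c} {R : Rep P c} → Tracks R R id D.id
  tracks-id = tracks (Eq.trans identityʳ (Eq.sym (Eq.trans (∘-resp-≈ˡ identity) identityˡ)))

  module _ {P Q U c d u} {R : Rep P c} {S : Rep Q d} {T : Rep U u} where
    private
      module R = Iso R
      module S = Iso S
      module T = Iso T

    tracks-∘ : ∀ {f g f′ g′} → Tracks S T f f′ → Tracks R S g g′ → Tracks R T (f ∘ g) (f′ D.∘ g′)
    tracks-∘ {f} {g} {f′} {g′} (tracks p) (tracks q) = tracks (begin
      T.to ∘ f ∘ g              ≈⟨ pullˡ p ⟩
      (F₁ f′ ∘ S.to) ∘ g        ≈⟨ pullʳ q ⟩
      F₁ f′ ∘ F₁ g′ ∘ R.to      ≈⟨ pullˡ (Eq.sym homomorphism) ⟩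
      F₁ (f′ D.∘ g′) ∘ R.to     ∎)

    tracks-⟨⟩ : ∀ {f g f′ g′} → Tracks T R f f′ → Tracks T S g g′ →
                Tracks T (R ⊗ᵣ S) ⟨ f , g ⟩ BD.⟨ f′ , g′ ⟩
    tracks-⟨⟩ {f} {g} {f′} {g′} (tracks p) (tracks q) = tracks (begin
      (⊗F.to ∘ (R.to ⁂ S.to)) ∘ ⟨ f , g ⟩      ≈⟨ pullʳ ⁂∘⟨⟩ ⟩
      ⊗F.to ∘ ⟨ R.to ∘ f , S.to ∘ g ⟩          ≈⟨ ∘-resp-≈ʳ (⟨⟩-cong p q) ⟩
      ⊗F.to ∘ ⟨ F₁ f′ ∘ T.to , F₁ g′ ∘ T.to ⟩  ≈⟨ ∘-resp-≈ʳ ⟨⟩∘ ⟩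
      ⊗F.to ∘ ⟨ F₁ f′ , F₁ g′ ⟩ ∘ T.to         ≈⟨ pullˡ (Eq.sym F-⟨⟩) ⟩
      F₁ BD.⟨ f′ , g′ ⟩ ∘ T.to                 ∎)

    tracks-[] : ∀ {f g f′ g′} → Tracks R T f f′ → Tracks S T g g′ →
                Tracks (R ⊕ᵣ S) T [ f , g ] BD.[ f′ , g′ ]
    tracks-[] {f} {g} {f′} {g′} (tracks p) (tracks q) = tracks (begin
      T.to ∘ [ f , g ]                          ≈⟨ ∘[] ⟩
      [ T.to ∘ f , T.to ∘ g ]                   ≈⟨ []-cong p q ⟩
      [ F₁ f′ ∘ R.to , F₁ g′ ∘ S.to ]           ≈⟨ []∘⊕₁ ⟨
      [ F₁ f′ , F₁ g′ ] ∘ (R.to ⊕₁ S.to)        ≈⟨ pullˡ F-[] ⟨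
      F₁ BD.[ f′ , g′ ] ∘ ⊕F.to ∘ (R.to ⊕₁ S.to) ∎)

  tracks-! : ∀ {P c} {R : Rep P c} → Tracks R 𝟙-iso ! BD.!
  tracks-! = tracks (morphisms-into-terminal-equal 𝟙-iso _ _)

  tracks-¡ : ∀ {P c} {R : Rep P c} → Tracks 𝟘-iso R ¡ BD.¡
  tracks-¡ = tracks ¡-unique₂

  module _ {P Q c d} (R : Rep P c) (S : Rep Q d) where
    private
      module R = Iso R
      module S = Iso S

    tracks-π₁ : Tracks (R ⊗ᵣ S) R π₁ BD.π₁
    tracks-π₁ = tracks (Eq.sym (Eq.trans (pullˡ F-π₁) project₁))

    tracks-π₂ : Tracks (R ⊗ᵣ S) S π₂ BD.π₂
    tracks-π₂ = tracks (Eq.sym (Eq.trans (pullˡ F-π₂) project₂))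

    tracks-swap : Tracks (R ⊗ᵣ S) (S ⊗ᵣ R) swap BD.swap
    tracks-swap = tracks-⟨⟩ tracks-π₂ tracks-π₁

    tracks-i₁ : Tracks R (R ⊕ᵣ S) i₁ BD.i₁
    tracks-i₁ = tracks (Eq.trans (pullʳ inject₁) (pullˡ F-i₁))

    tracks-i₂ : Tracks S (R ⊕ᵣ S) i₂ BD.i₂
    tracks-i₂ = tracks (Eq.trans (pullʳ inject₂) (pullˡ F-i₂))

    tracks-eval : Tracks ((R ⇨ᵣ S) ⊗ᵣ R) S eval BD.eval
    tracks-eval = tracks (begin
      S.to ∘ eval
        ≈⟨ ∘-resp-≈ʳ (elimʳ (Eq.trans (⁂-cong Eq.refl R.isoˡ) ⁂-identity)) ⟨
      S.to ∘ eval ∘ (id ⁂ (R.from ∘ R.to))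
        ≈⟨ pullʳ (pullʳ second∘second) ⟨
      (S.to ∘ eval ∘ (id ⁂ R.from)) ∘ (id ⁂ R.to)
        ≈⟨ ∘-resp-≈ˡ β ⟨
      (eval ∘ ((R.from ⇨₁ S.to) ⁂ id)) ∘ (id ⁂ R.to)
        ≈⟨ pullʳ first∘second ⟩
      eval ∘ ((R.from ⇨₁ S.to) ⁂ R.to)
        ≈⟨ ∘-resp-≈ˡ F-eval ⟨
      (F₁ BD.eval ∘ ⊗F.to ∘ (⇨F.to ⁂ id)) ∘ ((R.from ⇨₁ S.to) ⁂ R.to)
        ≈⟨ pullʳ (pullʳ (Eq.trans ⁂∘⁂ (⁂-cong Eq.refl identityˡ))) ⟩
      F₁ BD.eval ∘ ⊗F.to ∘ ((⇨F.to ∘ (R.from ⇨₁ S.to)) ⁂ R.to)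
        ∎)

    tracks-curry : ∀ {U u} {T : Rep U u} {f f′} → Tracks (T ⊗ᵣ R) S f f′ →
                   Tracks T (R ⇨ᵣ S) (curry f) (BD.curry f′)
    tracks-curry {T = T} {f} {f′} (tracks p) = tracks (begin
      (⇨F.to ∘ (R.from ⇨₁ S.to)) ∘ curry f
        ≈⟨ pullʳ ⇨₁∘curry ⟩
      ⇨F.to ∘ curry (S.to ∘ f ∘ (id ⁂ R.from))
        ≈⟨ ∘-resp-≈ʳ (curry-cong (pullˡ p)) ⟩
      ⇨F.to ∘ curry ((F₁ f′ ∘ ⊗F.to ∘ (T.to ⁂ R.to)) ∘ (id ⁂ R.from))
        ≈⟨ ∘-resp-≈ʳ (curry-cong (pullʳ (pullʳ (Eq.trans ⁂∘⁂ (⁂-cong identityʳ R.isoʳ))))) ⟩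
      ⇨F.to ∘ curry (F₁ f′ ∘ ⊗F.to ∘ (T.to ⁂ id))
        ≈⟨ ∘-resp-≈ʳ (curry-cong assoc) ⟨
      ⇨F.to ∘ curry ((F₁ f′ ∘ ⊗F.to) ∘ (T.to ⁂ id))
        ≈⟨ ∘-resp-≈ʳ curry-∘ ⟨
      ⇨F.to ∘ curry (F₁ f′ ∘ ⊗F.to) ∘ T.to
        ≈⟨ pullˡ (Eq.sym F-curry) ⟩
      F₁ (BD.curry f′) ∘ T.to
        ∎)
      where module T = Iso T

  module _ {b} {Base : Set b} (⟦_⟧ᵇ : Base → D.Obj) where
    open Syntax Base
    private
      module I = Interp D BD ⟦_⟧ᵇ
      module J = Interp E BE (λ β → F₀ ⟦ β ⟧ᵇ)

    θ : ∀ A → Rep J.⟦ A ⟧T I.⟦ A ⟧T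
    θ (base β) = idᵢ
    θ `1       = 𝟙-iso
    θ (A `× B) = θ A ⊗ᵣ θ B
    θ `0       = 𝟘-iso
    θ (A `+ B) = θ A ⊕ᵣ θ B
    θ (A `→ B) = θ A ⇨ᵣ θ B

    θ-context : ∀ Γ → Rep J.⟦ Γ ⟧C I.⟦ Γ ⟧C
    θ-context ∅       = 𝟙-iso
    θ-context (Γ , A) = θ-context Γ ⊗ᵣ θ A

    tracks-⟦_⟧v : ∀ {Γ A} (x : Γ ∋ A) → Tracks (θ-context Γ) (θ A) J.⟦ x ⟧v I.⟦ x ⟧v
    tracks-⟦_⟧v {Γ , A} here          = tracks-π₂ (θ-context Γ) (θ A)
    tracks-⟦_⟧v {Γ , B} (there x)     = tracks-∘ tracks-⟦ x ⟧v (tracks-π₁ (θ-context Γ) (θ B))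

    tracks-⟦_⟧ : ∀ {Γ A} (M : Γ ⊢ A) → Tracks (θ-context Γ) (θ A) J.⟦ M ⟧ I.⟦ M ⟧
    tracks-⟦ var x ⟧ = tracks-⟦ x ⟧v
    tracks-⟦ unit ⟧ = tracks-!
    tracks-⟦ pair M N ⟧ = tracks-⟨⟩ tracks-⟦ M ⟧ tracks-⟦ N ⟧
    tracks-⟦ fst {A = A} {B} M ⟧ = tracks-∘ (tracks-π₁ (θ A) (θ B)) tracks-⟦ M ⟧
    tracks-⟦ snd {A = A} {B} M ⟧ = tracks-∘ (tracks-π₂ (θ A) (θ B)) tracks-⟦ M ⟧
    tracks-⟦ absurd M ⟧ = tracks-∘ tracks-¡ tracks-⟦ M ⟧
    tracks-⟦ inl {A = A} {B} M ⟧ = tracks-∘ (tracks-i₁ (θ A) (θ B)) tracks-⟦ M ⟧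
    tracks-⟦ inr {A = A} {B} M ⟧ = tracks-∘ (tracks-i₂ (θ A) (θ B)) tracks-⟦ M ⟧
    tracks-⟦_⟧ {Γ} (case {A = A} {B} {C} N M₁ M₂) =
      tracks-∘ (tracks-eval (θ-context Γ) (θ C))
        (tracks-⟨⟩ (tracks-∘ (tracks-[] (branch M₁) (branch M₂)) tracks-⟦ N ⟧) tracks-id)
      where
        branch : ∀ {X} (M : Γ , X ⊢ C) →
                 Tracks (θ X) (θ-context Γ ⇨ᵣ θ C) (curry (J.⟦ M ⟧ ∘ swap)) (BD.curry (I.⟦ M ⟧ D.∘ BD.swap))
        branch {X} M =
          tracks-curry (θ-context Γ) (θ C) (tracks-∘ tracks-⟦ M ⟧ (tracks-swap (θ X) (θ-context Γ)))
    tracks-⟦ lam {A = A} {B} M ⟧ = tracks-curry (θ A) (θ B) tracks-⟦ M ⟧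
    tracks-⟦ app {A = A} {B} M N ⟧ =
      tracks-∘ (tracks-eval (θ A) (θ B)) (tracks-⟨⟩ tracks-⟦ M ⟧ tracks-⟦ N ⟧)

module YonedaEmbedding {o ℓ e} (C : Category o ℓ e) (BC : BCC C) (BP : BCC (Presheaves.PSh× C BC)) where
  open Presheaves C BC
  open Category C
  open BCC BC
  open CategoryProperties C
  open BCCProperties BC
  private
    module P = Category PSh×
    module BP = BCC BP
    module PP = CategoryProperties PSh×
    module BPP = BCCProperties BP
    variable
      A B c d : Obj

  El : PPresheaf → Obj → Set ℓ
  El F A = Setoid.Carrier (PPresheaf.F₀ F A)

  module At (F : PPresheaf) (A : Obj) = Setoid (PPresheaf.F₀ F A)

  ≈-at : (F : PPresheaf) (A : Obj) → El F A → El F A → Set e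
  ≈-at F A = At._≈_ F A

  infix 4 ≈-at
  syntax ≈-at F A x x′ = x ≈[ F ∣ A ] x′

  open PPresheaf using (act)
  open NatTrans using (app)

  app-cong : ∀ {F G} (α : NatTrans F G) {x x′ : El F A} → x ≈[ F ∣ A ] x′ → app α A x ≈[ G ∣ A ] app α A x′
  app-cong α = Func.cong (NatTrans.η α _)

  act-cong : ∀ F (f : A ⇒ B) {x x′ : El F B} → x ≈[ F ∣ B ] x′ → act F f x ≈[ F ∣ A ] act F f x′
  act-cong F f = Func.cong (PPresheaf.F₁ F f)

  yoneda : ∀ F → El F c → NatTrans (y c) F
  yoneda F x = record
    { η       = λ A → record { to = λ g → act F g x ; cong = λ p → PPresheaf.F-resp-≈ F p x }
    ; natural = λ k g → PPresheaf.homomorphism F x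
    }

  yoneda-cong : ∀ F {x x′ : El F c} → x ≈[ F ∣ c ] x′ → yoneda F x P.≈ yoneda F x′
  yoneda-cong F p A g = act-cong F g p

  ∘-yoneda : ∀ {F G} (α : NatTrans F G) (x : El F c) → α P.∘ yoneda F x P.≈ yoneda G (app α c x)
  ∘-yoneda α x A g = NatTrans.natural α g x

  yoneda-∘-y₁ : ∀ F (x : El F d) (f : c ⇒ d) → yoneda F x P.∘ y₁ f P.≈ yoneda F (act F f x)
  yoneda-∘-y₁ F x f A g = PPresheaf.homomorphism F x

  yoneda-app-id : ∀ {G} (α : NatTrans (y c) G) → yoneda G (app α c id) P.≈ α
  yoneda-app-id {G = G} α A g =
    At.trans G A (At.sym G A (NatTrans.natural α g id)) (app-cong α identityˡ)

  -- BP.⊗ is an arbitrary choice of products, not necessarily the pointwise one; by Yoneda its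
  -- elements over A are nevertheless exactly pairs of elements over A.
  module ProductElements (P Q : PPresheaf) where
    private
      PQ = P BP.⊗ Q

    fst : El PQ A → El P A
    fst {A} = app (BP.π₁ {P} {Q}) A

    snd : El PQ A → El Q A
    snd {A} = app (BP.π₂ {P} {Q}) A

    fst-⟨⟩ : ∀ {X} (f : NatTrans X P) (g : NatTrans X Q) (x : El X A) →
             fst (app BP.⟨ f , g ⟩ A x) ≈[ P ∣ A ] app f A x
    fst-⟨⟩ {A} f g x = BP.project₁ {f = f} {g = g} A x

    snd-⟨⟩ : ∀ {X} (f : NatTrans X P) (g : NatTrans X Q) (x : El X A) →
             snd (app BP.⟨ f , g ⟩ A x) ≈[ Q ∣ A ] app g A x
    snd-⟨⟩ {A} f g x = BP.project₂ {f = f} {g = g} A x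

    pair : El P A → El Q A → El PQ A
    pair {A} a b = app BP.⟨ yoneda P a , yoneda Q b ⟩ A id

    fst-pair : ∀ (a : El P A) b → fst (pair a b) ≈[ P ∣ A ] a
    fst-pair {A} a b = At.trans P A (fst-⟨⟩ (yoneda P a) (yoneda Q b) id) (PPresheaf.identity P a)

    snd-pair : ∀ (a : El P A) b → snd (pair a b) ≈[ Q ∣ A ] b
    snd-pair {A} a b = At.trans Q A (snd-⟨⟩ (yoneda P a) (yoneda Q b) id) (PPresheaf.identity Q b)

    pair-cong : ∀ {a a′ : El P A} {b b′} → a ≈[ P ∣ A ] a′ → b ≈[ Q ∣ A ] b′ →
                pair a b ≈[ PQ ∣ A ] pair a′ b′
    pair-cong p q = BP.⟨⟩-cong (yoneda-cong P p) (yoneda-cong Q q) _ id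

    pair-η : ∀ (w : El PQ A) → pair (fst w) (snd w) ≈[ PQ ∣ A ] w
    pair-η {A} w = At.trans PQ A (pairing-yoneda A id) (PPresheaf.identity PQ w)
      where
        pairing-yoneda : BP.⟨ yoneda P (fst w) , yoneda Q (snd w) ⟩ P.≈ yoneda PQ w
        pairing-yoneda = BP.⊗-unique {h = yoneda PQ w} (∘-yoneda {A} (BP.π₁ {P} {Q}) w)
                                                       (∘-yoneda {A} (BP.π₂ {P} {Q}) w)

    fst-snd-ext : ∀ {w w′ : El PQ A} → fst w ≈[ P ∣ A ] fst w′ → snd w ≈[ Q ∣ A ] snd w′ →
                  w ≈[ PQ ∣ A ] w′
    fst-snd-ext {A} {w} {w′} p q = begin
      w                      ≈⟨ pair-η w ⟨
      pair (fst w) (snd w)   ≈⟨ pair-cong p q ⟩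
      pair (fst w′) (snd w′) ≈⟨ pair-η w′ ⟩
      w′                     ∎
      where open SetoidReasoning (PPresheaf.F₀ PQ A)

    pair-unique : ∀ {w : El PQ A} {a b} → fst w ≈[ P ∣ A ] a → snd w ≈[ Q ∣ A ] b → w ≈[ PQ ∣ A ] pair a b
    pair-unique {A} p q =
      fst-snd-ext (At.trans P A p (At.sym P A (fst-pair _ _))) (At.trans Q A q (At.sym Q A (snd-pair _ _)))

    pair-natural : ∀ (k : B ⇒ A) a b → act PQ k (pair a b) ≈[ PQ ∣ B ] pair (act P k a) (act Q k b)
    pair-natural {B} {A} k a b = pair-unique
      (At.trans P B (NatTrans.natural BP.π₁ k (pair a b)) (act-cong P k (fst-pair a b)))
      (At.trans Q B (NatTrans.natural BP.π₂ k (pair a b)) (act-cong Q k (snd-pair a b)))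

  open ProductElements

  y-functor : Functor C PSh×
  y-functor = record
    { F₀           = y
    ; F₁           = y₁
    ; F-resp-≈     = λ p A g → ∘-resp-≈ˡ p
    ; identity     = λ A g → identityˡ
    ; homomorphism = λ A g → assoc
    }

  ε : NatTrans BP.𝟙 (y 𝟙)
  ε = record
    { η       = λ A → record { to = λ _ → ! ; cong = λ _ → Eq.refl }
    ; natural = λ k _ → !-unique _
    }

  y-𝟙 : Iso PSh× BP.𝟙 (y 𝟙)
  y-𝟙 = record
    { to   = ε
    ; from = BP.!
    ; isoˡ = BPP.!-unique₂ {f = BP.! P.∘ ε} {g = P.id}
    ; isoʳ = λ A g → !-unique g
    }

  φ : ∀ c d → NatTrans (y c BP.⊗ y d) (y (c ⊗ d))
  φ c d = record
    { η       = λ A → record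
        { to   = λ z → ⟨ fst (y c) (y d) z , snd (y c) (y d) z ⟩
        ; cong = λ p → ⟨⟩-cong (app-cong BP.π₁ p) (app-cong BP.π₂ p)
        }
    ; natural = λ k z → Eq.trans (⟨⟩-cong (NatTrans.natural BP.π₁ k z) (NatTrans.natural BP.π₂ k z)) ⟨⟩∘
    }

  y-π₁ : y₁ π₁ P.∘ φ c d P.≈ BP.π₁
  y-π₁ A z = project₁

  y-π₂ : y₁ π₂ P.∘ φ c d P.≈ BP.π₂
  y-π₂ A z = project₂

  y-⊗ : ∀ c d → Iso PSh× (y c BP.⊗ y d) (y (c ⊗ d))
  y-⊗ c d = record
    { to   = φ c d
    ; from = BP.⟨ y₁ π₁ , y₁ π₂ ⟩
    ; isoˡ = BPP.⊗-ext {h = BP.⟨ y₁ π₁ , y₁ π₂ ⟩ P.∘ φ c d} {k = P.id}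
               (λ A z → Eq.trans (fst-⟨⟩ (y c) (y d) (y₁ π₁) (y₁ π₂) _) project₁)
               (λ A z → Eq.trans (snd-⟨⟩ (y c) (y d) (y₁ π₁) (y₁ π₂) _) project₂)
    ; isoʳ = λ A m → Eq.trans (⟨⟩-cong (fst-⟨⟩ (y c) (y d) (y₁ π₁) (y₁ π₂) m)
                                       (snd-⟨⟩ (y c) (y d) (y₁ π₁) (y₁ π₂) m))
                              (⊗-unique Eq.refl Eq.refl)
    }

  -- Only here is product preservation used: it gives BP.𝟘 a point over 𝟘, and y c ⊕ y d a point over
  -- c ⊕ d restricting to the two coprojections; these are the generic elements of the inverses.
  y-𝟘 : Iso PSh× BP.𝟘 (y 𝟘)
  y-𝟘 = record
    { to   = BP.¡
    ; from = yoneda BP.𝟘 x₀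
    ; isoˡ = BPP.¡-unique₂ {f = yoneda BP.𝟘 x₀ P.∘ BP.¡} {g = P.id}
    ; isoʳ = λ A g → Eq.trans (NatTrans.natural (BP.¡ {y 𝟘}) g x₀) (elimˡ ¡-unique₂)
    }
    where
      x₀ : El BP.𝟘 𝟘
      x₀ = proj₁ (IsProductPreserving.pres-𝟘 (PPresheaf.preserves BP.𝟘))

  module CoproductComparison (c d : Obj) where
    S : PPresheaf
    S = y c BP.⊕ y d

    ψ : NatTrans S (y (c ⊕ d))
    ψ = BP.[ y₁ i₁ , y₁ i₂ ]

    ψ∘i₁ : ψ P.∘ BP.i₁ P.≈ y₁ i₁
    ψ∘i₁ = BP.inject₁ {f = y₁ i₁} {g = y₁ i₂}

    ψ∘i₂ : ψ P.∘ BP.i₂ P.≈ y₁ i₂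
    ψ∘i₂ = BP.inject₂ {f = y₁ i₁} {g = y₁ i₂}

    private
      W = IsProductPreserving.pres-⊕-surj (PPresheaf.preserves S) (app BP.i₁ c id) (app BP.i₂ d id)

    w : El S (c ⊕ d)
    w = proj₁ W

    private
      module _ {x} (ι : NatTrans (y x) S) (ι′ : x ⇒ c ⊕ d) (ψι : ψ P.∘ ι P.≈ y₁ ι′)
               (wι : act S ι′ w ≈[ S ∣ x ] app ι x id) where
        yoneda-w∘ψ-restricts : (yoneda S w P.∘ ψ) P.∘ ι P.≈ P.id P.∘ ι
        yoneda-w∘ψ-restricts = begin
          (yoneda S w P.∘ ψ) P.∘ ι    ≈⟨ PP.pullʳ {g = ψ} {h = ι} {k = y₁ ι′} {f = yoneda S w} ψι ⟩
          yoneda S w P.∘ y₁ ι′        ≈⟨ yoneda-∘-y₁ S w ι′ ⟩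
          yoneda S (act S ι′ w)       ≈⟨ yoneda-cong S wι ⟩
          yoneda S (app ι x id)       ≈⟨ yoneda-app-id ι ⟩
          ι                           ≈⟨ P.identityˡ {f = ι} ⟨
          P.id P.∘ ι                  ∎
          where open PP.HomReasoning

        ψw-restricts : app ψ (c ⊕ d) w ∘ ι′ ≈ id ∘ ι′
        ψw-restricts = begin
          app ψ (c ⊕ d) w ∘ ι′      ≈⟨ NatTrans.natural ψ ι′ w ⟨
          app ψ x (act S ι′ w)      ≈⟨ app-cong ψ wι ⟩
          app ψ x (app ι x id)      ≈⟨ ψι x id ⟩
          ι′ ∘ id                   ≈⟨ identityʳ ⟩
          ι′                        ≈⟨ identityˡ ⟨
          id ∘ ι′                   ∎
          where open HomReasoning


    yoneda-w∘ψ≈id : yoneda S w P.∘ ψ P.≈ P.id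
    yoneda-w∘ψ≈id = BPP.⊕-ext {h = yoneda S w P.∘ ψ} {k = P.id}
      (yoneda-w∘ψ-restricts BP.i₁ i₁ ψ∘i₁ (proj₁ (proj₂ W)))
      (yoneda-w∘ψ-restricts BP.i₂ i₂ ψ∘i₂ (proj₂ (proj₂ W)))

    ψ∘yoneda-w≈id : ψ P.∘ yoneda S w P.≈ P.id
    ψ∘yoneda-w≈id A g = Eq.trans (NatTrans.natural ψ g w) (elimˡ ψw≈id)
      where
        ψw≈id : app ψ (c ⊕ d) w ≈ id
        ψw≈id = ⊕-ext (ψw-restricts BP.i₁ i₁ ψ∘i₁ (proj₁ (proj₂ W)))
                      (ψw-restricts BP.i₂ i₂ ψ∘i₂ (proj₂ (proj₂ W)))

  y-⊕ : ∀ c d → Iso PSh× (y c BP.⊕ y d) (y (c ⊕ d))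
  y-⊕ c d = record { to = ψ ; from = yoneda S w ; isoˡ = yoneda-w∘ψ≈id ; isoʳ = ψ∘yoneda-w≈id }
    where open CoproductComparison c d

  ⁂-pair : ∀ {P Q P′ Q′} (f : NatTrans P P′) (g : NatTrans Q Q′) (a : El P A) (b : El Q A) →
           app (f BP.⁂ g) A (pair P Q a b) ≈[ P′ BP.⊗ Q′ ∣ A ] pair P′ Q′ (app f A a) (app g A b)
  ⁂-pair {A} {P} {Q} {P′} {Q′} f g a b = pair-unique P′ Q′
    (At.trans P′ A (fst-⟨⟩ P′ Q′ (f P.∘ BP.π₁) (g P.∘ BP.π₂) (pair P Q a b))
                   (app-cong f (fst-pair P Q a b)))
    (At.trans Q′ A (snd-⟨⟩ P′ Q′ (f P.∘ BP.π₁) (g P.∘ BP.π₂) (pair P Q a b))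
                   (app-cong g (snd-pair P Q a b)))

  eval-pair-curry : ∀ {X Q R} (g : NatTrans (X BP.⊗ Q) R) (x : El X A) (q : El Q A) →
                    app BP.eval A (pair (Q BP.⇨ R) Q (app (BP.curry g) A x) q) ≈[ R ∣ A ] app g A (pair X Q x q)
  eval-pair-curry {A} {X} {Q} {R} g x q =
    At.trans R A (app-cong BP.eval (At.sym ((Q BP.⇨ R) BP.⊗ Q) A (⁂-pair (BP.curry g) P.id x q)))
                 (BPP.β {f = g} A (pair X Q x q))

  -- Λ h transposes by pairing x, moved to A ⊗ c, with the generic element π₂ of y c over A ⊗ c.
  module Transpose {G : PPresheaf} (h : NatTrans (G BP.⊗ y c) (y d)) where
    uncurried : El G A → A ⊗ c ⇒ d
    uncurried {A} x = app h (A ⊗ c) (pair G (y c) (act G π₁ x) π₂)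

    private
      uncurried-∘ : ∀ (x : El G A) (k : B ⇒ A) (g : B ⇒ c) →
                    uncurried x ∘ ⟨ k , g ⟩ ≈ app h B (pair G (y c) (act G k x) g)
      uncurried-∘ {A} {B} x k g = begin
        uncurried x ∘ ⟨ k , g ⟩
          ≈⟨ NatTrans.natural h ⟨ k , g ⟩ _ ⟨
        app h B (act (G BP.⊗ y c) ⟨ k , g ⟩ (pair G (y c) (act G π₁ x) π₂))
          ≈⟨ app-cong h (pair-natural G (y c) ⟨ k , g ⟩ _ _) ⟩
        app h B (pair G (y c) (act G ⟨ k , g ⟩ (act G π₁ x)) (π₂ ∘ ⟨ k , g ⟩))
          ≈⟨ app-cong h (pair-cong G (y c) restrict project₂) ⟩
        app h B (pair G (y c) (act G k x) g)
          ∎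
        where
          open HomReasoning
          restrict : act G ⟨ k , g ⟩ (act G π₁ x) ≈[ G ∣ B ] act G k x
          restrict = At.trans G B (At.sym G B (PPresheaf.homomorphism G x)) (PPresheaf.F-resp-≈ G project₁ x)

      uncurried-natural : ∀ (k : B ⇒ A) (x : El G A) → uncurried (act G k x) ≈ uncurried x ∘ (k ⁂ id)
      uncurried-natural k x = Eq.sym (Eq.trans (uncurried-∘ x (k ∘ π₁) (id ∘ π₂))
                                               (app-cong h (pair-cong G (y c) (PPresheaf.homomorphism G x) identityˡ)))

    Λ : NatTrans G (y (c ⇨ d))
    Λ = record
      { η       = λ A → record
          { to   = λ x → curry (uncurried x)
          ; cong = λ p → curry-cong (app-cong h (pair-cong G (y c) (act-cong G π₁ p) Eq.refl))
          }
      ; natural = λ k x → Eq.trans (curry-cong (uncurried-natural k x)) (Eq.sym curry-∘)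
      }

    Λ-β : ∀ (x : El G A) (g : A ⇒ c) → eval ∘ ⟨ app Λ A x , g ⟩ ≈ app h A (pair G (y c) x g)
    Λ-β {A} x g = begin
      eval ∘ ⟨ curry (uncurried x) , g ⟩       ≈⟨ ∘-resp-≈ʳ (⟨⟩-cong identityʳ Eq.refl) ⟨
      eval ∘ ⟨ curry (uncurried x) ∘ id , g ⟩  ≈⟨ eval∘⟨curry⟩ ⟩
      uncurried x ∘ ⟨ id , g ⟩                 ≈⟨ uncurried-∘ x id g ⟩
      app h A (pair G (y c) (act G id x) g)    ≈⟨ app-cong h (pair-cong G (y c) (PPresheaf.identity G x) Eq.refl) ⟩
      app h A (pair G (y c) x g)               ∎
      where open HomReasoning

  open Transpose using (Λ; Λ-β; uncurried)

  y-eval : y₁ eval P.∘ φ (c ⇨ d) c P.∘ (Λ (BP.eval {y c} {y d}) BP.⁂ P.id) P.≈ BP.eval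
  y-eval {c} {d} A z = begin
    eval ∘ ⟨ fst Y Yc (app (L BP.⁂ P.id) A z) , snd Y Yc (app (L BP.⁂ P.id) A z) ⟩
        ≈⟨ ∘-resp-≈ʳ (⟨⟩-cong (fst-⟨⟩ Y Yc (L P.∘ BP.π₁) (P.id P.∘ BP.π₂) z)
                              (snd-⟨⟩ Y Yc (L P.∘ BP.π₁) (P.id P.∘ BP.π₂) z)) ⟩
    eval ∘ ⟨ app L A (fst E Yc z) , snd E Yc z ⟩
        ≈⟨ Λ-β BP.eval (fst E Yc z) (snd E Yc z) ⟩
    app BP.eval A (pair E Yc (fst E Yc z) (snd E Yc z))
        ≈⟨ app-cong BP.eval (pair-η E Yc z) ⟩
    app BP.eval A z ∎
    where
      open HomReasoning
      Y = y (c ⇨ d)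
      Yc = y c
      E = y c BP.⇨ y d
      L = Λ (BP.eval {y c} {y d})

  y-⇨ : ∀ c d → Iso PSh× (y c BP.⇨ y d) (y (c ⇨ d))
  y-⇨ c d = record
    { to   = L
    ; from = BP.curry ev
    ; isoˡ = BPP.curry∘≈id {f = ev} {h = L} y-eval
    ; isoʳ = λ A m → Eq.sym (curry-unique (uncurry-curry m))
    }
    where
      L = Λ (BP.eval {y c} {y d})
      ev = y₁ eval P.∘ φ (c ⇨ d) c

      uncurry-curry : ∀ {A} (m : A ⇒ c ⇨ d) →
                      eval ∘ ⟨ m ∘ π₁ , π₂ ⟩ ≈ uncurried BP.eval (app (BP.curry ev) A m)
      uncurry-curry {A} m = begin
        eval ∘ ⟨ m ∘ π₁ , π₂ ⟩
          ≈⟨ ∘-resp-≈ʳ (⟨⟩-cong (fst-pair Y (y c) (m ∘ π₁) π₂) (snd-pair Y (y c) (m ∘ π₁) π₂)) ⟨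
        app ev (A ⊗ c) (pair Y (y c) (m ∘ π₁) π₂)
          ≈⟨ eval-pair-curry ev (m ∘ π₁) π₂ ⟨
        app BP.eval (A ⊗ c) (pair E (y c) (app (BP.curry ev) (A ⊗ c) (m ∘ π₁)) π₂)
          ≈⟨ app-cong BP.eval (pair-cong E (y c) (NatTrans.natural (BP.curry ev) π₁ m) Eq.refl) ⟩
        uncurried BP.eval (app (BP.curry ev) A m) ∎
        where
          open HomReasoning
          Y = y (c ⇨ d)
          E = y c BP.⇨ y d

  yoneda-strong : StrongBCCFunctor BC BP
  yoneda-strong = record
    { functor = y-functor
    ; 𝟙-iso   = y-𝟙
    ; ⊗-iso   = y-⊗
    ; F-π₁    = y-π₁
    ; F-π₂    = y-π₂
    ; 𝟘-iso   = y-𝟘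
    ; ⊕-iso   = y-⊕
    ; F-i₁    = λ {c} {d} → CoproductComparison.ψ∘i₁ c d
    ; F-i₂    = λ {c} {d} → CoproductComparison.ψ∘i₂ c d
    ; ⇨-iso   = y-⇨
    ; F-eval  = y-eval
    }

module PresheafInterpretation {o ℓ e b} (C : Category o ℓ e) (BC : BCC C) {Base : Set b}
                               (⟦_⟧ᵇ : Base → Category.Obj C) (BP : BCC (Presheaves.PSh× C BC)) where
  open Comparison C BC ⟦_⟧ᵇ BP
  open Syntax Base
  open StrongBCCFunctorProperties (YonedaEmbedding.yoneda-strong C BC BP)

  θ-context≈i∘∏θ : ∀ Γ → Iso.to (θ-context ⟦_⟧ᵇ Γ) P.≈ i Γ P.∘ ∏θ (θ ⟦_⟧ᵇ) Γ
  θ-context≈i∘∏θ ∅       A x = C.Eq.refl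
  θ-context≈i∘∏θ (Γ , A) =
    to-⊗ᵣ-factors (θ-context ⟦_⟧ᵇ Γ) (θ ⟦_⟧ᵇ A) {f = i Γ} {g = ∏θ (θ ⟦_⟧ᵇ) Γ} (θ-context≈i∘∏θ Γ)

  θ-square : ∀ {Γ A} (M : Γ ⊢ A) →
             Iso.to (θ ⟦_⟧ᵇ A) P.∘ Iᴾ.⟦ M ⟧ P.≈ Presheaves.y₁ C BC Iᶜ.⟦ M ⟧ P.∘ (i Γ P.∘ ∏θ (θ ⟦_⟧ᵇ) Γ)
  θ-square {Γ} M A x =
    C.Eq.trans (Tracks.square (tracks-⟦_⟧ ⟦_⟧ᵇ M) A x) (C.∘-resp-≈ C.Eq.refl (θ-context≈i∘∏θ Γ A x))

lemma5p4 : {o ℓ e b : Level} (C : Category o ℓ e) (BC : BCC C)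
           (Base : Set b) (⟦_⟧ᵇ : Base → Category.Obj C)
           (BP : BCC (Presheaves.PSh× C BC)) →
           let open Comparison C BC ⟦_⟧ᵇ BP
               open Syntax Base
           in Σ[ θ ∈ (∀ A → Iso (Presheaves.PSh× C BC) (Iᴾ.⟦ A ⟧T) (Presheaves.y C BC (Iᶜ.⟦ A ⟧T))) ]
                (∀ {Γ A} (M : Γ ⊢ A) →
                   Iso.to (θ A) P.∘ Iᴾ.⟦ M ⟧
                     P.≈ Presheaves.y₁ C BC Iᶜ.⟦ M ⟧ P.∘ (i Γ P.∘ ∏θ θ Γ))
lemma5p4 C BC Base ⟦_⟧ᵇ BP = θ ⟦_⟧ᵇ , θ-square
  where
    open StrongBCCFunctorProperties (YonedaEmbedding.yoneda-strong C BC BP)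
    open PresheafInterpretation C BC ⟦_⟧ᵇ BP
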